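{- For all positive integers $m,n$, $$\gamma^{p}_{I}(K_m\,\square\, K_n)=\begin{cases} n, & m=n,\\ \min\{2m,2n\}, & m\ne n,\end{cases}$$ where $K_k$ denotes the complete graph on $k$ vertices.
   Context: All graphs are finite and simple. A perfect Italian dominating function (PID-function) of a graph $G$ is a function $f:V(G)\to\{0,1,2\}$ such that for every vertex $v$ with $f(v)=0$ we have $\sum_{u\in N(v)}f(u)=2$, where $N(v)$ is the open neighborhood of $v$. Its weight is $\sum_{u\in V(G)}f(u)$. The perfect Italian domination number $\gamma^{p}_{I}(G)$ is the minimum weight of a PID-function of $G$. The Cartesian product $G\square H$ has vertex set $V(G)\times V(H)$, with $(u_1,v_1)$ adjacent to $(u_2,v_2)$ iff either $u_1=u_2$ and $v_1v_2\in E(H)$, or $v_1=v_2$ and $u_1u_2\in E(G)$. -}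

module Defs where

open import Data.Nat using (ℕ; zero; suc; _+_; _*_; _≤_)
open import Data.Nat.Properties using (_≟_)
open import Data.Bool using (Bool; true; false; if_then_else_; _∧_; _∨_; not)
open import Data.Fin using (Fin; toℕ; remQuot)
open import Data.Fin.Properties using () renaming (_≟_ to _≟ᶠ_)
open import Data.Product using (_×_; _,_; proj₁; proj₂; Σ)
open import Data.List using (List; map)
open import Data.Nat.ListAction using (sum)
open import Data.Bool.Properties using (∧-zeroʳ)
open import Data.List using () renaming (allFin to allFinL)
open import Relation.Binary.PropositionalEquality using (_≡_)
open import Relation.Nullary.Decidable using (⌊_⌋)

record Graph : Set where
  field
    order : ℕ
    adj   : Fin order → Fin order → Bool
    sym   : ∀ u v → adj u v ≡ adj v u
    irrefl : ∀ v → adj v v ≡ false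
open Graph public

Σ-Fin : (n : ℕ) → (Fin n → ℕ) → ℕ
Σ-Fin n g = sum (map g (allFinL n))

nbrSum : (G : Graph) → (Fin (order G) → Fin 3) → Fin (order G) → ℕ
nbrSum G f v = Σ-Fin (order G) (λ u → if adj G v u then toℕ (f u) else 0)

IsPID : (G : Graph) → (Fin (order G) → Fin 3) → Set
IsPID G f = ∀ v → toℕ (f v) ≡ 0 → nbrSum G f v ≡ 2

weight : (G : Graph) → (Fin (order G) → Fin 3) → ℕ
weight G f = Σ-Fin (order G) (λ u → toℕ (f u))

IsPIDNumber : Graph → ℕ → Set
IsPIDNumber G k =
  Σ (Fin (order G) → Fin 3) (λ f → IsPID G f × weight G f ≡ k)
  × (∀ f → IsPID G f → k ≤ weight G f)

complete : ℕ → Graph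
complete k = record
  { order = k
  ; adj = λ u v → not ⌊ u ≟ᶠ v ⌋
  ; sym = symK
  ; irrefl = irrK }
  where
  open import Relation.Nullary using (yes; no)
  open import Relation.Binary.PropositionalEquality using (refl) renaming (sym to ≡sym)
  symK : ∀ (u v : Fin k) → not ⌊ u ≟ᶠ v ⌋ ≡ not ⌊ v ≟ᶠ u ⌋
  symK u v with u ≟ᶠ v | v ≟ᶠ u
  ... | yes _ | yes _ = refl
  ... | no _  | no _  = refl
  ... | yes p | no q with q (≡sym p)
  ... | ()
  symK u v | no q | yes p with q (≡sym p)
  ... | ()
  irrK : ∀ (v : Fin k) → not ⌊ v ≟ᶠ v ⌋ ≡ false
  irrK v with v ≟ᶠ v
  ... | yes _ = refl
  ... | no q with q refl
  ... | ()

-- Cartesian product G □ H; vertex (a , b) ∈ V(G) × V(H) is encoded as an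
-- element of Fin (order G * order H) via the bijection remQuot.
_□_ : Graph → Graph → Graph
G □ H = record
  { order = order G * order H
  ; adj = λ x y → ad (remQuot (order H) x) (remQuot (order H) y)
  ; sym = λ x y → adSym (remQuot (order H) x) (remQuot (order H) y)
  ; irrefl = λ x → adIrr (remQuot (order H) x) }
  where
  open import Relation.Binary.PropositionalEquality using (refl; cong₂)
  eqG : Fin (order G) → Fin (order G) → Bool
  eqG a b = ⌊ a ≟ᶠ b ⌋
  eqH : Fin (order H) → Fin (order H) → Bool
  eqH a b = ⌊ a ≟ᶠ b ⌋
  ad : Fin (order G) × Fin (order H) → Fin (order G) × Fin (order H) → Bool
  ad (u₁ , v₁) (u₂ , v₂) = (eqG u₁ u₂ ∧ adj H v₁ v₂) ∨ (eqH v₁ v₂ ∧ adj G u₁ u₂)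
  open import Relation.Nullary using (yes; no)
  open import Relation.Binary.PropositionalEquality using () renaming (sym to ≡sym)
  eqSym : ∀ {n} (a b : Fin n) → ⌊ a ≟ᶠ b ⌋ ≡ ⌊ b ≟ᶠ a ⌋
  eqSym a b with a ≟ᶠ b | b ≟ᶠ a
  ... | yes _ | yes _ = refl
  ... | no _  | no _  = refl
  ... | yes p | no q with q (≡sym p)
  ... | ()
  eqSym a b | no q | yes p with q (≡sym p)
  ... | ()
  adSym : ∀ x y → ad x y ≡ ad y x
  adSym (u₁ , v₁) (u₂ , v₂) =
    cong₂ _∨_ (cong₂ _∧_ (eqSym u₁ u₂) (Graph.sym H v₁ v₂))
              (cong₂ _∧_ (eqSym v₁ v₂) (Graph.sym G u₁ u₂))
  adIrr : ∀ x → ad x x ≡ false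
  adIrr (u , v) rewrite Graph.irrefl H v | Graph.irrefl G u
    | ∧-zeroʳ (eqG u u) | ∧-zeroʳ (eqH v v) = refl

module Submission where

-- A labelling of K_m □ K_n is an m × n matrix g with entries in {0,1,2},
-- and its weight is the total of g.  The neighbours of cell (a , b) are the
-- other cells of row a and of column b, so (neighbourhood sum) + 2·g a b is
-- the row sum R a plus the column sum C b: F is a PID-function iff
--     g a b = 0  ⇒  R a + C b = 2.                  (row–column condition)
-- After some facts on finite sums, the bounds are proved for matrices:
-- an empty row forces every column sum to be 2 (total 2n), an empty column
-- gives total 2m by transposition; with no empty line the total is at
-- least n, and if m < n some row sum is ≥ 2, so that row is full and the
-- total is ≥ n + (m - 1) ≥ 2m.  The identity matrix (m = n) and a line of
-- 2s along the shorter side attain the bounds.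

open import Defs using (Graph; adj; Σ-Fin; nbrSum; IsPID; weight; IsPIDNumber; complete; _□_)
open import Data.Nat using (ℕ; zero; suc; _+_; _*_; _≤_; _<_; _⊓_; z≤n; z<s; _≤?_)
open import Data.Nat.Properties
  using ( +-*-semiring; +-identityʳ; +-comm; +-assoc; +-suc; *-comm; *-identityʳ; *-zeroʳ
        ; ≤-refl; ≤-trans; ≤-total; m≤m+n; m≤n+m; +-mono-≤; +-monoˡ-≤; *-monoʳ-≤
        ; n≤0⇒n≡0; n≢0⇒n>0; <⇒≤; <⇒≤pred; <⇒≱; ≰⇒>; <-cmp; m⊓n≤m; m⊓n≤n
        ; m≤n⇒m⊓n≡m; m≥n⇒m⊓n≡n; module ≤-Reasoning)
  renaming (_≟_ to _≟ℕ_)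
open import Data.Nat.ListAction as ℕList using ()
open import Data.Bool using (Bool; true; false; if_then_else_; _∧_; _∨_; not)
open import Data.Bool.Properties using (if-float)
open import Data.Fin using (Fin; zero; suc; toℕ; punchIn; remQuot; combine; _↑ˡ_; _↑ʳ_)
open import Data.Fin.Patterns using (0F; 1F; 2F)
open import Data.Fin.Properties using (any?; remQuot-combine; combine-remQuot) renaming (_≟_ to _≟ᶠ_)
open import Data.List using (tabulate)
open import Data.List.Properties using (map-tabulate)
open import Data.Product using (Σ; _×_; _,_; proj₁; proj₂; uncurry)
open import Data.Sum using (inj₁; inj₂)
open import Data.Vec.Functional using (removeAt)
open import Function using (_∘_; id; flip)
open import Relation.Binary.Definitions using (tri<; tri≈; tri>)
open import Relation.Binary.PropositionalEquality
  using (_≡_; _≢_; refl; sym; trans; cong; cong₂; subst; module ≡-Reasoning)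
open import Relation.Nullary using (yes; no; contradiction)
open import Relation.Nullary.Decidable using (⌊_⌋)

open import Algebra.Properties.Semiring.Sum +-*-semiring
  using (sum; sum-syntax; sum-cong-≗; sum-replicate-zero; sum-remove; ∑-distrib-+; ∑-comm; *-distribˡ-sum)

Σ-Fin≡∑ : ∀ n (f : Fin n → ℕ) → Σ-Fin n f ≡ sum f
Σ-Fin≡∑ n f = trans (cong ℕList.sum (map-tabulate id f)) (sum-tabulate f)
  where
  sum-tabulate : ∀ {k} (h : Fin k → ℕ) → ℕList.sum (tabulate h) ≡ sum h
  sum-tabulate {zero} h = refl
  sum-tabulate {suc k} h = cong (h zero +_) (sum-tabulate (h ∘ suc))

∑-const : ∀ n c → ∑[ i < n ] c ≡ n * c
∑-const zero c = refl
∑-const (suc n) c = cong (c +_) (∑-const n c)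

∑-mono : ∀ {n} {f h : Fin n → ℕ} → (∀ i → f i ≤ h i) → sum f ≤ sum h
∑-mono {zero} f≤h = z≤n
∑-mono {suc n} f≤h = +-mono-≤ (f≤h zero) (∑-mono (f≤h ∘ suc))

∑≡0⇒term≡0 : ∀ {n} (f : Fin n → ℕ) i → sum f ≡ 0 → f i ≡ 0
∑≡0⇒term≡0 f i ∑f≡0 = n≤0⇒n≡0 (subst (f i ≤_) ∑f≡0 (term≤∑ f i))
  where
  term≤∑ : ∀ {k} (h : Fin k → ℕ) j → h j ≤ sum h
  term≤∑ h zero = m≤m+n (h zero) _
  term≤∑ h (suc j) = ≤-trans (term≤∑ (h ∘ suc) j) (m≤n+m _ (h zero))

∑-≥-with-large-term : ∀ {n} (f : Fin (suc n) → ℕ) i {c} →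
                      (∀ j → 1 ≤ f j) → c ≤ f i → c + n ≤ sum f
∑-≥-with-large-term {n} f i {c} f≥1 c≤fi = begin
  c + n                    ≡⟨ cong (c +_) (trans (sym (*-identityʳ n)) (sym (∑-const n 1))) ⟩
  c + ∑[ j < n ] 1         ≤⟨ +-mono-≤ c≤fi (∑-mono (f≥1 ∘ punchIn i)) ⟩
  f i + sum (removeAt f i) ≡⟨ sym (sum-remove f) ⟩
  sum f                    ∎
  where open ≤-Reasoning

∑-split : ∀ n k (f : Fin (n + k) → ℕ) →
          sum f ≡ ∑[ i < n ] f (i ↑ˡ k) + ∑[ j < k ] f (n ↑ʳ j)
∑-split zero k f = refl
∑-split (suc n) k f =
  trans (cong (f zero +_) (∑-split n k (f ∘ suc))) (sym (+-assoc (f zero) _ _))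

∑-combine : ∀ m n (f : Fin (m * n) → ℕ) →
            sum f ≡ ∑[ a < m ] ∑[ b < n ] f (combine a b)
∑-combine zero n f = refl
∑-combine (suc m) n f =
  trans (∑-split n (m * n) f) (cong (∑[ b < n ] f (b ↑ˡ (m * n)) +_) (∑-combine m n (f ∘ (n ↑ʳ_))))

δ : ∀ {n} → Fin n → Fin n → Bool
δ i j = ⌊ i ≟ᶠ j ⌋

δ-suc : ∀ {n} (i j : Fin n) → δ (suc i) (suc j) ≡ δ i j
δ-suc i j with i ≟ᶠ j
... | yes _ = refl
... | no _ = refl

δ-sym : ∀ {n} (i j : Fin n) → δ i j ≡ δ j i
δ-sym i j with i ≟ᶠ j | j ≟ᶠ i
... | yes _ | yes _ = refl
... | no _  | no _  = refl
... | yes i≡j | no j≢i = contradiction (sym i≡j) j≢i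
... | no i≢j | yes j≡i = contradiction (sym j≡i) i≢j

∑-pick : ∀ {n} (i : Fin n) (h : Fin n → ℕ) →
         ∑[ j < n ] (if δ i j then h j else 0) ≡ h i
∑-pick {suc n} zero h = trans (cong (h zero +_) (sum-replicate-zero n)) (+-identityʳ (h zero))
∑-pick {suc n} (suc i) h =
  trans (sum-cong-≗ (λ j → cong (if_then h (suc j) else 0) (δ-suc i j))) (∑-pick i (h ∘ suc))

∑-if : ∀ {n} X (f : Fin n → ℕ) → ∑[ j < n ] (if X then f j else 0) ≡ (if X then sum f else 0)
∑-if true f = refl
∑-if {n} false f = sum-replicate-zero n

Matrix : ℕ → ℕ → Set
Matrix m n = Fin m → Fin n → ℕ

module _ {m n : ℕ} where

  rowSum : Matrix m n → Fin m → ℕ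
  rowSum g a = ∑[ b < n ] g a b

  colSum : Matrix m n → Fin n → ℕ
  colSum g b = ∑[ a < m ] g a b

  total : Matrix m n → ℕ
  total g = ∑[ a < m ] rowSum g a

  IsPIDMatrix : Matrix m n → Set
  IsPIDMatrix g = ∀ a b → g a b ≡ 0 → rowSum g a + colSum g b ≡ 2

  total-cong : {g g′ : Matrix m n} → (∀ a b → g a b ≡ g′ a b) → total g ≡ total g′
  total-cong g≗g′ = sum-cong-≗ (λ a → sum-cong-≗ (g≗g′ a))

  total-+ : (g g′ : Matrix m n) → total (λ a b → g a b + g′ a b) ≡ total g + total g′
  total-+ g g′ = trans (sum-cong-≗ (λ a → ∑-distrib-+ (g a) (g′ a))) (∑-distrib-+ (rowSum g) (rowSum g′))

  total-scale : ∀ c (g : Matrix m n) → total (λ a b → c * g a b) ≡ c * total g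
  total-scale c g = sym (trans (*-distribˡ-sum c (rowSum g)) (sum-cong-≗ (λ a → *-distribˡ-sum c (g a))))

  IsPIDMatrix-cong : {g g′ : Matrix m n} → (∀ a b → g a b ≡ g′ a b) → IsPIDMatrix g → IsPIDMatrix g′
  IsPIDMatrix-cong g≗g′ P a b g′ab≡0 =
    trans (sym (cong₂ _+_ (sum-cong-≗ (g≗g′ a)) (sum-cong-≗ (λ a′ → g≗g′ a′ b))))
          (P a b (trans (g≗g′ a b) g′ab≡0))

module _ {m n : ℕ} {g : Matrix m n} where

  IsPIDMatrix-flip : IsPIDMatrix g → IsPIDMatrix (flip g)
  IsPIDMatrix-flip P b a gab≡0 = trans (+-comm (colSum g b) (rowSum g a)) (P a b gab≡0)

  total-flip : total (flip g) ≡ total g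
  total-flip = sym (∑-comm g)

emptyRow⇒total : ∀ {m n} {g : Matrix m n} → IsPIDMatrix g → ∀ a → rowSum g a ≡ 0 → total g ≡ 2 * n
emptyRow⇒total {n = n} {g} P a Ra≡0 = begin
  total g                 ≡⟨ ∑-comm g ⟩
  ∑[ b < n ] colSum g b   ≡⟨ sum-cong-≗ colSum≡2 ⟩
  ∑[ b < n ] 2            ≡⟨ ∑-const n 2 ⟩
  n * 2                   ≡⟨ *-comm n 2 ⟩
  2 * n                   ∎
  where
  open ≡-Reasoning
  colSum≡2 : ∀ b → colSum g b ≡ 2
  colSum≡2 b = trans (cong (_+ colSum g b) (sym Ra≡0)) (P a b (∑≡0⇒term≡0 (g a) b Ra≡0))

module _ {m n : ℕ} {g : Matrix m n} (P : IsPIDMatrix g) where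

  emptyColumn⇒total : ∀ b → colSum g b ≡ 0 → total g ≡ 2 * m
  emptyColumn⇒total b Cb≡0 = trans (sym (total-flip {g = g})) (emptyRow⇒total (IsPIDMatrix-flip P) b Cb≡0)

  total≥n : (∀ b → 1 ≤ colSum g b) → n ≤ total g
  total≥n C≥1 = begin
    n                      ≡⟨ sym (trans (∑-const n 1) (*-identityʳ n)) ⟩
    ∑[ b < n ] 1           ≤⟨ ∑-mono C≥1 ⟩
    ∑[ b < n ] colSum g b  ≡⟨ total-flip {g = g} ⟩
    total g                ∎
    where open ≤-Reasoning

  -- A row whose sum is at least 2 has no zero entry (when no column is
  -- empty), since a zero would see a row plus column sum of at least 3.
  heavyRow⇒full : (∀ b → 1 ≤ colSum g b) → ∀ a → 2 ≤ rowSum g a → ∀ b → 1 ≤ g a b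
  heavyRow⇒full C≥1 a 2≤Ra b with g a b ≟ℕ 0
  ... | no gab≢0 = n≢0⇒n>0 gab≢0
  ... | yes gab≡0 = contradiction (subst (3 ≤_) (P a b gab≡0) (+-mono-≤ 2≤Ra (C≥1 b))) (<⇒≱ ≤-refl)

-- With no empty line and fewer rows than columns: not every row sum can be
-- at most 1 (the total would be ≤ m < n ≤ total), and a row with sum ≥ 2 is
-- full, hence total ≥ n + (m - 1) ≥ 2m.
total≥2m : ∀ {m n} {g : Matrix m n} → IsPIDMatrix g →
           (∀ a → 1 ≤ rowSum g a) → (∀ b → 1 ≤ colSum g b) → m < n → 2 * m ≤ total g
total≥2m {zero} _ _ _ _ = z≤n
total≥2m {suc m} {n} {g} P R≥1 C≥1 m<n with any? (λ a → 2 ≤? rowSum g a)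
... | no noHeavyRow = contradiction (≤-trans (total≥n P C≥1) total≤m) (<⇒≱ m<n)
  where
  open ≤-Reasoning
  total≤m : total g ≤ suc m
  total≤m = begin
    total g               ≤⟨ ∑-mono (λ a → <⇒≤pred (≰⇒> (λ 2≤Ra → noHeavyRow (a , 2≤Ra)))) ⟩
    ∑[ a < suc m ] 1      ≡⟨ trans (∑-const (suc m) 1) (*-identityʳ (suc m)) ⟩
    suc m                 ∎
... | yes (a , 2≤Ra) = begin
    2 * suc m             ≡⟨ cong suc (trans (cong (m +_) (+-identityʳ (suc m))) (+-suc m m)) ⟩
    suc (suc m) + m       ≤⟨ +-monoˡ-≤ m m<n ⟩
    n + m                 ≤⟨ ∑-≥-with-large-term (rowSum g) a R≥1 n≤Ra ⟩
    total g               ∎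
  where
  open ≤-Reasoning
  n≤Ra : n ≤ rowSum g a
  n≤Ra = begin
    n                     ≡⟨ sym (trans (∑-const n 1) (*-identityʳ n)) ⟩
    ∑[ b < n ] 1          ≤⟨ ∑-mono (heavyRow⇒full P C≥1 a 2≤Ra) ⟩
    rowSum g a            ∎

module _ {m n : ℕ} {g : Matrix m n} (P : IsPIDMatrix g) where

  byLines : ∀ {t} → t ≤ 2 * n → t ≤ 2 * m →
            ((∀ a → 1 ≤ rowSum g a) → (∀ b → 1 ≤ colSum g b) → t ≤ total g) → t ≤ total g
  byLines {t} t≤2n t≤2m noEmptyLine
    with any? (λ a → rowSum g a ≟ℕ 0) | any? (λ b → colSum g b ≟ℕ 0)
  ... | yes (a , Ra≡0) | _ = subst (t ≤_) (sym (emptyRow⇒total P a Ra≡0)) t≤2n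
  ... | no _ | yes (b , Cb≡0) = subst (t ≤_) (sym (emptyColumn⇒total P b Cb≡0)) t≤2m
  ... | no noEmptyRow | no noEmptyColumn =
    noEmptyLine (λ a → n≢0⇒n>0 (λ Ra≡0 → noEmptyRow (a , Ra≡0)))
                (λ b → n≢0⇒n>0 (λ Cb≡0 → noEmptyColumn (b , Cb≡0)))

  rectangle-lower : m < n → 2 * m ≤ total g
  rectangle-lower m<n =
    byLines (*-monoʳ-≤ 2 (<⇒≤ m<n)) ≤-refl (λ R≥1 C≥1 → total≥2m P R≥1 C≥1 m<n)

square-lower : ∀ {n} {g : Matrix n n} → IsPIDMatrix g → n ≤ total g
square-lower {n} P = byLines P (m≤m+n n _) (m≤m+n n _) (λ _ C≥1 → total≥n P C≥1)

unequal-lower : ∀ {m n} {g : Matrix m n} → IsPIDMatrix g → m ≢ n → (2 * m) ⊓ (2 * n) ≤ total g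
unequal-lower {m} {n} {g} P m≢n with <-cmp m n
... | tri< m<n _ _ = ≤-trans (m⊓n≤m (2 * m) (2 * n)) (rectangle-lower P m<n)
... | tri≈ _ m≡n _ = contradiction m≡n m≢n
... | tri> _ _ n<m = ≤-trans (m⊓n≤n (2 * m) (2 * n))
                       (subst (2 * n ≤_) (total-flip {g = g}) (rectangle-lower (IsPIDMatrix-flip P) n<m))

values : ∀ {m n} → (Fin m → Fin n → Fin 3) → Matrix m n
values h a b = toℕ (h a b)

Attains : ∀ m n → ℕ → Set
Attains m n k = Σ (Fin m → Fin n → Fin 3) (λ h → IsPIDMatrix (values h) × total (values h) ≡ k)

diagonal : ∀ {n} → Fin n → Fin n → Fin 3
diagonal a b = if δ a b then 1F else 0F

diagonal-attains : ∀ {n} → Attains n n n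
diagonal-attains {n} = diagonal , (λ a b _ → cong₂ _+_ (rowSum≡1 a) (colSum≡1 b)) , total≡n
  where
  I : Matrix n n
  I = values diagonal
  entry : ∀ a b → I a b ≡ (if δ a b then 1 else 0)
  entry a b = if-float toℕ (δ a b)
  rowSum≡1 : ∀ a → rowSum I a ≡ 1
  rowSum≡1 a = trans (sum-cong-≗ (entry a)) (∑-pick a (λ _ → 1))
  colSum≡1 : ∀ b → colSum I b ≡ 1
  colSum≡1 b = trans (sum-cong-≗ (λ a → trans (entry a b) (cong (if_then 1 else 0) (δ-sym a b))))
                     (∑-pick b (λ _ → 1))
  total≡n : total I ≡ n
  total≡n = trans (sum-cong-≗ rowSum≡1) (trans (∑-const n 1) (*-identityʳ n))

firstColumn : ∀ {m n} → Fin m → Fin (suc n) → Fin 3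
firstColumn a b = if δ 0F b then 2F else 0F

firstColumn-attains : ∀ {m n} → Attains m (suc n) (2 * m)
firstColumn-attains {m} {n} = firstColumn , pid , total≡2m
  where
  C : Matrix m (suc n)
  C = values firstColumn
  entry : ∀ a b → C a b ≡ (if δ 0F b then 2 else 0)
  entry a b = if-float toℕ (δ 0F b)
  rowSum≡2 : ∀ a → rowSum C a ≡ 2
  rowSum≡2 a = trans (sum-cong-≗ (entry a)) (∑-pick {suc n} 0F (λ _ → 2))
  -- the entries of a column do not depend on the row
  pid : IsPIDMatrix C
  pid a b entry≡0 = cong₂ _+_ (rowSum≡2 a)
    (trans (∑-const m (C a b)) (trans (cong (m *_) entry≡0) (*-zeroʳ m)))
  total≡2m : total C ≡ 2 * m
  total≡2m = trans (sum-cong-≗ rowSum≡2) (trans (∑-const m 2) (*-comm m 2))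

line-attains : ∀ {m n} → 0 < m → 0 < n → Attains m n ((2 * m) ⊓ (2 * n))
line-attains {suc m} {suc n} z<s z<s with ≤-total (suc m) (suc n)
... | inj₁ m≤n = let (h , P , total≡2m) = firstColumn-attains {suc m} {n} in
  h , P , trans total≡2m (sym (m≤n⇒m⊓n≡m (*-monoʳ-≤ 2 m≤n)))
... | inj₂ n≤m = let (h , P , total≡2n) = firstColumn-attains {suc n} {m} in
  flip h , IsPIDMatrix-flip P ,
  trans (total-flip {g = values h}) (trans total≡2n (sym (m≥n⇒m⊓n≡n (*-monoʳ-≤ 2 n≤m))))

Rook : ℕ → ℕ → Graph
Rook m n = complete m □ complete n

-- Pointwise bookkeeping for a cell in the same row (X) and/or the same
-- column (Y) as a centre: adjacency counts the value once unless the cell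
-- is the centre, which the row and the column indicators both count.
rook-split : ∀ X Y v →
  (if (X ∧ not Y) ∨ (Y ∧ not X) then v else 0) + 2 * (if X then (if Y then v else 0) else 0)
  ≡ (if X then v else 0) + (if Y then v else 0)
rook-split true  true  v = cong (v +_) (+-identityʳ v)
rook-split true  false v = refl
rook-split false true  v = +-identityʳ v
rook-split false false v = refl

module _ {m n : ℕ} where

  entries : (Fin (m * n) → Fin 3) → Matrix m n
  entries F a b = toℕ (F (combine a b))

  weight≡total : ∀ F → weight (Rook m n) F ≡ total (entries F)
  weight≡total F = trans (Σ-Fin≡∑ (m * n) _) (∑-combine m n _)

  adj-combine : ∀ a b a′ b′ → adj (Rook m n) (combine a b) (combine a′ b′)
                              ≡ (δ a a′ ∧ not (δ b b′)) ∨ (δ b b′ ∧ not (δ a a′))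
  adj-combine a b a′ b′ = cong₂ shareOne (remQuot-combine a b) (remQuot-combine a′ b′)
    where
    shareOne : Fin m × Fin n → Fin m × Fin n → Bool
    shareOne p q = (δ (proj₁ p) (proj₁ q) ∧ not (δ (proj₂ p) (proj₂ q)))
                 ∨ (δ (proj₂ p) (proj₂ q) ∧ not (δ (proj₁ p) (proj₁ q)))

  nbrSum-combine : ∀ F a b → nbrSum (Rook m n) F (combine a b) + 2 * entries F a b
                             ≡ rowSum (entries F) a + colSum (entries F) b
  nbrSum-combine F a b = begin
    nbrSum (Rook m n) F (combine a b) + 2 * g a b
      ≡⟨ cong₂ (λ s t → s + 2 * t) (trans (Σ-Fin≡∑ (m * n) _) (∑-combine m n _)) (sym centre≡) ⟩
    total nbrT + 2 * total centreT
      ≡⟨ cong (total nbrT +_) (sym (total-scale 2 centreT)) ⟩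
    total nbrT + total (λ a′ b′ → 2 * centreT a′ b′)
      ≡⟨ sym (total-+ nbrT _) ⟩
    total (λ a′ b′ → nbrT a′ b′ + 2 * centreT a′ b′)
      ≡⟨ total-cong split ⟩
    total (λ a′ b′ → rowT a′ b′ + colT a′ b′)
      ≡⟨ total-+ rowT colT ⟩
    total rowT + total colT
      ≡⟨ cong₂ _+_ row≡ col≡ ⟩
    rowSum g a + colSum g b ∎
    where
    open ≡-Reasoning
    g nbrT rowT colT centreT : Matrix m n
    g = entries F
    nbrT a′ b′ = if adj (Rook m n) (combine a b) (combine a′ b′) then g a′ b′ else 0
    rowT a′ b′ = if δ a a′ then g a′ b′ else 0
    colT a′ b′ = if δ b b′ then g a′ b′ else 0
    centreT a′ b′ = if δ a a′ then colT a′ b′ else 0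
    split : ∀ a′ b′ → nbrT a′ b′ + 2 * centreT a′ b′ ≡ rowT a′ b′ + colT a′ b′
    split a′ b′ = trans (cong (λ X → (if X then g a′ b′ else 0) + 2 * centreT a′ b′) (adj-combine a b a′ b′))
                        (rook-split (δ a a′) (δ b b′) (g a′ b′))
    centre≡ : total centreT ≡ g a b
    centre≡ = trans (sum-cong-≗ (λ a′ → trans (∑-if (δ a a′) (colT a′))
                                              (cong (λ s → if δ a a′ then s else 0) (∑-pick b (g a′)))))
                    (∑-pick a (λ a′ → g a′ b))
    row≡ : total rowT ≡ rowSum g a
    row≡ = trans (sum-cong-≗ (λ a′ → ∑-if (δ a a′) (g a′))) (∑-pick a (rowSum g))
    col≡ : total colT ≡ colSum g b
    col≡ = sum-cong-≗ (λ a′ → ∑-pick b (g a′))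

  IsPID⇒IsPIDMatrix : ∀ F → IsPID (Rook m n) F → IsPIDMatrix (entries F)
  IsPID⇒IsPIDMatrix F pid a b gab≡0 =
    trans (sym (nbrSum-combine F a b)) (cong₂ (λ s t → s + 2 * t) (pid (combine a b) gab≡0) gab≡0)

  IsPIDMatrix⇒IsPID : ∀ F → IsPIDMatrix (entries F) → IsPID (Rook m n) F
  IsPIDMatrix⇒IsPID F P v =
    subst (λ x → toℕ (F x) ≡ 0 → nbrSum (Rook m n) F x ≡ 2) (combine-remQuot {m} n v)
          (atCell (proj₁ (remQuot {m} n v)) (proj₂ (remQuot {m} n v)))
    where
    atCell : ∀ a b → entries F a b ≡ 0 → nbrSum (Rook m n) F (combine a b) ≡ 2
    atCell a b gab≡0 = begin
      s                                            ≡⟨ sym (+-identityʳ s) ⟩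
      s + 2 * 0                                    ≡⟨ cong (λ t → s + 2 * t) (sym gab≡0) ⟩
      s + 2 * entries F a b                        ≡⟨ nbrSum-combine F a b ⟩
      rowSum (entries F) a + colSum (entries F) b  ≡⟨ P a b gab≡0 ⟩
      2                                            ∎
      where
      open ≡-Reasoning
      s : ℕ
      s = nbrSum (Rook m n) F (combine a b)

  fromMatrix : (Fin m → Fin n → Fin 3) → Fin (m * n) → Fin 3
  fromMatrix h x = uncurry h (remQuot n x)

  entries-fromMatrix : ∀ h a b → entries (fromMatrix h) a b ≡ values h a b
  entries-fromMatrix h a b = cong (toℕ ∘ uncurry h) (remQuot-combine a b)

  IsPIDNumber-byMatrices : ∀ {k} → Attains m n k →
    (∀ (g : Matrix m n) → IsPIDMatrix g → k ≤ total g) → IsPIDNumber (Rook m n) k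
  IsPIDNumber-byMatrices {k} (h , P , total≡k) lower = (fromMatrix h , pid , weight≡k) , minimal
    where
    pid : IsPID (Rook m n) (fromMatrix h)
    pid = IsPIDMatrix⇒IsPID (fromMatrix h) (IsPIDMatrix-cong (λ a b → sym (entries-fromMatrix h a b)) P)
    weight≡k : weight (Rook m n) (fromMatrix h) ≡ k
    weight≡k = trans (weight≡total (fromMatrix h)) (trans (total-cong (entries-fromMatrix h)) total≡k)
    minimal : ∀ F → IsPID (Rook m n) F → k ≤ weight (Rook m n) F
    minimal F pidF = subst (k ≤_) (sym (weight≡total F)) (lower (entries F) (IsPID⇒IsPIDMatrix F pidF))

theorem4p4 : ∀ (m n : ℕ) → 0 < m → 0 < n →
    (m ≡ n → IsPIDNumber (complete m □ complete n) n)
    × (m ≢ n → IsPIDNumber (complete m □ complete n) ((2 * m) ⊓ (2 * n)))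
theorem4p4 m n 0<m 0<n = square , unequal
  where
  square : m ≡ n → IsPIDNumber (Rook m n) n
  square refl = IsPIDNumber-byMatrices diagonal-attains (λ g → square-lower)
  unequal : m ≢ n → IsPIDNumber (Rook m n) ((2 * m) ⊓ (2 * n))
  unequal m≢n = IsPIDNumber-byMatrices (line-attains 0<m 0<n) (λ g P → unequal-lower P m≢n)
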